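{- Let $R$ be a p.q.-Baer $*$-ring and let $e,f$ be nontrivial central projections of $R$ (i.e. $e,f\notin\{0,1\}$) with $e+f\neq 1$. If $ef=0$, then $d(1-e,1-f)=3$ in $\Gamma^*_s(R)$.
   Context: A $*$-ring is a ring $R$ with an involution $x\mapsto x^*$. A projection is an element $e$ with $e^2=e=e^*$; a central projection is a projection in the centre of $R$. For $S\subseteq R$, $r_R(S)=\{x\in R: sx=0\ \forall s\in S\}$. $R$ is a p.q.-Baer $*$-ring if for every $a\in R$, $r_R(aR)=eR$ for some projection $e\in R$. The strong zero-divisor graph $\Gamma^*_s(R)$ is the simple undirected graph with vertex set $\{0\neq a\in R: r_R(aR)\neq\{0\}\}$, distinct vertices $a,b$ adjacent iff $aRb^*=0$. $d(x,y)$ is the length of a shortest path joining $x$ and $y$. -}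

module Defs where

open import Level using (Level; _⊔_)
open import Algebra.Bundles using (Ring)
open import Data.Nat as ℕ using (ℕ)
open import Data.Product using (Σ; ∃; _×_)
open import Relation.Nullary using (¬_)
open import Function.Bundles using (_⇔_)

record IsInvolution {c ℓ : Level} (R : Ring c ℓ) (_⋆ : Ring.Carrier R → Ring.Carrier R)
       : Set (c ⊔ ℓ) where
  open Ring R
  field
    ⋆-cong  : ∀ {x y} → x ≈ y → x ⋆ ≈ y ⋆
    ⋆-+     : ∀ x y → (x + y) ⋆ ≈ (x ⋆) + (y ⋆)
    ⋆-*     : ∀ x y → (x * y) ⋆ ≈ (y ⋆) * (x ⋆)
    ⋆-invol : ∀ x → (x ⋆) ⋆ ≈ x

module StarRingDefs {c ℓ : Level} (R : Ring c ℓ) (_⋆ : Ring.Carrier R → Ring.Carrier R) where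
  open Ring R

  IsProjection : Carrier → Set ℓ
  IsProjection e = (e * e ≈ e) × (e ⋆ ≈ e)

  IsCentralProjection : Carrier → Set (c ⊔ ℓ)
  IsCentralProjection e = IsProjection e × (∀ x → e * x ≈ x * e)

  InRightAnnOfPrincipal : Carrier → Carrier → Set (c ⊔ ℓ)
  InRightAnnOfPrincipal a x = ∀ r → (a * r) * x ≈ 0#

  InRightIdeal : Carrier → Carrier → Set (c ⊔ ℓ)
  InRightIdeal e x = ∃ λ y → x ≈ e * y

  IsPQBaer : Set (c ⊔ ℓ)
  IsPQBaer = ∀ a → ∃ λ e → IsProjection e ×
               (∀ x → InRightAnnOfPrincipal a x ⇔ InRightIdeal e x)

  -- vertices of Γ*_s(R): nonzero a with r_R(aR) ≠ {0}
  IsVertex : Carrier → Set (c ⊔ ℓ)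
  IsVertex a = (¬ a ≈ 0#) × (∃ λ x → (¬ x ≈ 0#) × InRightAnnOfPrincipal a x)

  Adj : Carrier → Carrier → Set (c ⊔ ℓ)
  Adj a b = IsVertex a × IsVertex b × (¬ a ≈ b) × (∀ r → (a * r) * (b ⋆) ≈ 0#)

  data Walk : Carrier → Carrier → ℕ → Set (c ⊔ ℓ) where
    here : ∀ {x y} → IsVertex x → x ≈ y → Walk x y ℕ.zero
    step : ∀ {x y z n} → Adj x y → Walk y z n → Walk x z (ℕ.suc n)

  -- d(x, y) = n : a walk of length n exists and none shorter
  -- (a shortest walk is a shortest path)
  Dist : Carrier → Carrier → ℕ → Set (c ⊔ ℓ)
  Dist x y n = Walk x y n × (∀ m → m ℕ.< n → ¬ Walk x y m)

{-# OPTIONS --safe #-}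
-- The path 1 - e — e — f — 1 - f is a walk of length 3 because, for central
-- projections, p R q* = R p q vanishes as soon as p q = 0. No shorter walk exists:
-- 1 - e = 1 - f would force e = e e = e f = 0; an edge between 1 - e and 1 - f
-- gives (1 - e)(1 - f) = 0, whence 1 - e = f (1 - e) = f, contradicting e + f ≠ 1;
-- and a common neighbour y satisfies y (1 - e) = 0 = y (1 - f), so y = y f e = 0.
module Submission where

open import Defs
open import Level using (Level; _⊔_)
open import Algebra.Bundles using (Ring)
open import Data.Nat using (suc; _<_; s≤s)
open import Data.Product using (∃; _×_; _,_)
open import Relation.Nullary using (¬_)
import Algebra.Properties.Ring as RingProperties
import Relation.Binary.Reasoning.Setoid as SetoidReasoning

module RingLemmas {c ℓ : Level} (R : Ring c ℓ) where
  open Ring R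
  open RingProperties R
  open SetoidReasoning setoid

  Central : Carrier → Set (c ⊔ ℓ)
  Central p = ∀ x → p * x ≈ x * p

  x-0≈x : ∀ x → x - 0# ≈ x
  x-0≈x x = trans (+-congˡ -0#≈0#) (+-identityʳ x)

  x+[y-x]≈y : ∀ x y → x + (y - x) ≈ y
  x+[y-x]≈y x y = begin
    x + (y - x)   ≈⟨ +-comm x (y - x) ⟩
    (y - x) + x   ≈⟨ +-assoc y (- x) x ⟩
    y + (- x + x) ≈⟨ +-congˡ (-‿inverseˡ x) ⟩
    y + 0#        ≈⟨ +-identityʳ y ⟩
    y             ∎

  1-x≈1-y⇒x≈y : ∀ {x y} → 1# - x ≈ 1# - y → x ≈ y
  1-x≈1-y⇒x≈y eq = -‿injective (+-cancelˡ 1# _ _ eq)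

  x*[1-y]≈x-x*y : ∀ x y → x * (1# - y) ≈ x - x * y
  x*[1-y]≈x-x*y x y = trans (x[y-z]≈xy-xz x 1# y) (+-congʳ (*-identityʳ x))

  [1-y]*x≈x-y*x : ∀ x y → (1# - y) * x ≈ x - y * x
  [1-y]*x≈x-y*x x y = trans ([y-z]x≈yx-zx x 1# y) (+-congʳ (*-identityˡ x))

  x*y≈0⇒x*[1-y]≈x : ∀ {x y} → x * y ≈ 0# → x * (1# - y) ≈ x
  x*y≈0⇒x*[1-y]≈x {x} {y} xy≈0 =
    trans (x*[1-y]≈x-x*y x y) (trans (+-congˡ (-‿cong xy≈0)) (x-0≈x x))

  x*[1-y]≈0⇒x≈x*y : ∀ {x y} → x * (1# - y) ≈ 0# → x ≈ x * y
  x*[1-y]≈0⇒x≈x*y {x} {y} eq = x∙y⁻¹≈ε⇒x≈y x (x * y) (trans (sym (x*[1-y]≈x-x*y x y)) eq)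

  x*x≈x⇒x*[1-x]≈0 : ∀ {p} → p * p ≈ p → p * (1# - p) ≈ 0#
  x*x≈x⇒x*[1-x]≈0 {p} pp≈p =
    trans (x*[1-y]≈x-x*y p p) (trans (+-congˡ (-‿cong pp≈p)) (-‿inverseʳ p))

  x*x≈x⇒[1-x]*x≈0 : ∀ {p} → p * p ≈ p → (1# - p) * p ≈ 0#
  x*x≈x⇒[1-x]*x≈0 {p} pp≈p =
    trans ([1-y]*x≈x-y*x p p) (trans (+-congˡ (-‿cong pp≈p)) (-‿inverseʳ p))

  x*x≈x⇒[1-x]*[1-x]≈1-x : ∀ {p} → p * p ≈ p → (1# - p) * (1# - p) ≈ 1# - p
  x*x≈x⇒[1-x]*[1-x]≈1-x pp≈p = x*y≈0⇒x*[1-y]≈x (x*x≈x⇒[1-x]*x≈0 pp≈p)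

  x*x≈x⇒x*y≈0⇒x≈y⇒x≈0 : ∀ {p q} → p * p ≈ p → p * q ≈ 0# → p ≈ q → p ≈ 0#
  x*x≈x⇒x*y≈0⇒x≈y⇒x≈0 {p} {q} pp≈p pq≈0 p≈q = begin
    p     ≈⟨ pp≈p ⟨
    p * p ≈⟨ *-congˡ p≈q ⟩
    p * q ≈⟨ pq≈0 ⟩
    0#    ∎

  central⇒central-[1-x] : ∀ {p} → Central p → Central (1# - p)
  central⇒central-[1-x] {p} central x = begin
    (1# - p) * x ≈⟨ [1-y]*x≈x-y*x x p ⟩
    x - p * x    ≈⟨ +-congˡ (-‿cong (central x)) ⟩
    x - x * p    ≈⟨ x*[1-y]≈x-x*y x p ⟨
    x * (1# - p) ∎

  central⇒x*y≈0⇒x*r*y≈0 : ∀ {p q} → Central p → p * q ≈ 0# → ∀ r → (p * r) * q ≈ 0#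
  central⇒x*y≈0⇒x*r*y≈0 {p} {q} central pq≈0 r = begin
    (p * r) * q ≈⟨ *-congʳ (central r) ⟩
    (r * p) * q ≈⟨ *-assoc r p q ⟩
    r * (p * q) ≈⟨ *-congˡ pq≈0 ⟩
    r * 0#      ≈⟨ zeroʳ r ⟩
    0#          ∎

  [1-x]*[1-y]≈0⇒x+y≈1 : ∀ {p q} → Central q → q * p ≈ 0# →
                        (1# - p) * (1# - q) ≈ 0# → p + q ≈ 1#
  [1-x]*[1-y]≈0⇒x+y≈1 {p} {q} central qp≈0 eq = begin
    p + q        ≈⟨ +-congˡ 1-p≈q ⟨
    p + (1# - p) ≈⟨ x+[y-x]≈y p 1# ⟩
    1#           ∎
    where
    1-p≈q : 1# - p ≈ q
    1-p≈q = begin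
      1# - p       ≈⟨ x*[1-y]≈0⇒x≈x*y eq ⟩
      (1# - p) * q ≈⟨ central (1# - p) ⟨
      q * (1# - p) ≈⟨ x*y≈0⇒x*[1-y]≈x qp≈0 ⟩
      q            ∎

  x≈x*p⇒x≈x*q⇒q*p≈0⇒x≈0 : ∀ {x p q} → x ≈ x * p → x ≈ x * q → q * p ≈ 0# → x ≈ 0#
  x≈x*p⇒x≈x*q⇒q*p≈0⇒x≈0 {x} {p} {q} x≈xp x≈xq qp≈0 = begin
    x           ≈⟨ x≈xp ⟩
    x * p       ≈⟨ *-congʳ x≈xq ⟩
    (x * q) * p ≈⟨ *-assoc x q p ⟩
    x * (q * p) ≈⟨ *-congˡ qp≈0 ⟩
    x * 0#      ≈⟨ zeroʳ x ⟩
    0#          ∎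

module InvolutionLemmas {c ℓ : Level} (R : Ring c ℓ) (_⋆ : Ring.Carrier R → Ring.Carrier R)
                        (involution : IsInvolution R _⋆) where
  open Ring R
  open IsInvolution involution
  open RingProperties R
  open RingLemmas R
  open StarRingDefs R _⋆
  open SetoidReasoning setoid

  0⋆≈0 : 0# ⋆ ≈ 0#
  0⋆≈0 = x+x≈x⇒x≈0 (0# ⋆) (trans (sym (⋆-+ 0# 0#)) (⋆-cong (+-identityʳ 0#)))

  1⋆≈1 : 1# ⋆ ≈ 1#
  1⋆≈1 = begin
    1# ⋆                ≈⟨ *-identityʳ (1# ⋆) ⟨
    (1# ⋆) * 1#         ≈⟨ *-congˡ (⋆-invol 1#) ⟨
    (1# ⋆) * (1# ⋆) ⋆   ≈⟨ ⋆-* (1# ⋆) 1# ⟨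
    ((1# ⋆) * 1#) ⋆     ≈⟨ ⋆-cong (*-identityʳ (1# ⋆)) ⟩
    (1# ⋆) ⋆            ≈⟨ ⋆-invol 1# ⟩
    1#                  ∎

  -x⋆≈-[x⋆] : ∀ x → (- x) ⋆ ≈ - (x ⋆)
  -x⋆≈-[x⋆] x = +-inverseˡ-unique ((- x) ⋆) (x ⋆)
    (trans (sym (⋆-+ (- x) x)) (trans (⋆-cong (-‿inverseˡ x)) 0⋆≈0))

  [1-x]⋆≈1-x : ∀ {p} → p ⋆ ≈ p → (1# - p) ⋆ ≈ 1# - p
  [1-x]⋆≈1-x {p} p⋆≈p = trans (⋆-+ 1# (- p)) (+-cong 1⋆≈1 (trans (-x⋆≈-[x⋆] p) (-‿cong p⋆≈p)))

  x*y⋆≈0⇒y*x⋆≈0 : ∀ {x y} → x * y ⋆ ≈ 0# → y * x ⋆ ≈ 0#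
  x*y⋆≈0⇒y*x⋆≈0 {x} {y} eq = begin
    y * x ⋆         ≈⟨ *-congʳ (⋆-invol y) ⟨
    (y ⋆) ⋆ * x ⋆   ≈⟨ ⋆-* x (y ⋆) ⟨
    (x * y ⋆) ⋆     ≈⟨ ⋆-cong eq ⟩
    0# ⋆            ≈⟨ 0⋆≈0 ⟩
    0#              ∎

  x*[1-p]⋆≈0⇒x*[1-p]≈0 : ∀ {x p} → p ⋆ ≈ p → x * (1# - p) ⋆ ≈ 0# → x * (1# - p) ≈ 0#
  x*[1-p]⋆≈0⇒x*[1-p]≈0 p⋆≈p = trans (*-congˡ (sym ([1-x]⋆≈1-x p⋆≈p)))

  complement-isCentralProjection : ∀ {p} → IsCentralProjection p → IsCentralProjection (1# - p)
  complement-isCentralProjection ((pp≈p , p⋆≈p) , central) =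
    (x*x≈x⇒[1-x]*[1-x]≈1-x pp≈p , [1-x]⋆≈1-x p⋆≈p) , central⇒central-[1-x] central

module GraphLemmas {c ℓ : Level} (R : Ring c ℓ) (_⋆ : Ring.Carrier R → Ring.Carrier R)
                   (involution : IsInvolution R _⋆) where
  open Ring R
  open IsInvolution involution
  open RingProperties R
  open RingLemmas R
  open InvolutionLemmas R _⋆ involution
  open StarRingDefs R _⋆

  central⇒isVertex : ∀ {p q} → Central p → ¬ p ≈ 0# → ¬ q ≈ 0# → p * q ≈ 0# → IsVertex p
  central⇒isVertex central p≉0 q≉0 pq≈0 = p≉0 , _ , q≉0 , central⇒x*y≈0⇒x*r*y≈0 central pq≈0

  nontrivial⇒isVertex : ∀ {p} → IsCentralProjection p → ¬ p ≈ 0# → ¬ p ≈ 1# →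
                        IsVertex p × IsVertex (1# - p)
  nontrivial⇒isVertex {p} ((pp≈p , _) , central) p≉0 p≉1 =
    central⇒isVertex central p≉0 1-p≉0 (x*x≈x⇒x*[1-x]≈0 pp≈p) ,
    central⇒isVertex (central⇒central-[1-x] central) 1-p≉0 p≉0 (x*x≈x⇒[1-x]*x≈0 pp≈p)
    where
    1-p≉0 : ¬ 1# - p ≈ 0#
    1-p≉0 eq = p≉1 (sym (x∙y⁻¹≈ε⇒x≈y 1# p eq))

  orthogonal⇒adj : ∀ {p q} → IsCentralProjection p → IsVertex p → IsVertex q →
                   q ⋆ ≈ q → p * q ≈ 0# → Adj p q
  orthogonal⇒adj ((pp≈p , _) , central) vp@(p≉0 , _) vq q⋆≈q pq≈0 =
    vp , vq , (λ p≈q → p≉0 (x*x≈x⇒x*y≈0⇒x≈y⇒x≈0 pp≈p pq≈0 p≈q)) ,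
    λ r → trans (*-congˡ q⋆≈q) (central⇒x*y≈0⇒x*r*y≈0 central pq≈0 r)

  adj⇒x*y⋆≈0 : ∀ {x y} → Adj x y → x * y ⋆ ≈ 0#
  adj⇒x*y⋆≈0 {x} (_ , _ , _ , xRy⋆≈0) = trans (*-congʳ (sym (*-identityʳ x))) (xRy⋆≈0 1#)

  walk₀⇒≈ : ∀ {x y} → Walk x y 0 → x ≈ y
  walk₀⇒≈ (here _ x≈y) = x≈y

  walk₁⇒x*y⋆≈0 : ∀ {x y} → Walk x y 1 → x * y ⋆ ≈ 0#
  walk₁⇒x*y⋆≈0 (step adj (here _ z≈y)) = trans (*-congˡ (⋆-cong (sym z≈y))) (adj⇒x*y⋆≈0 adj)

  walk₂⇒commonNeighbour : ∀ {x y} → Walk x y 2 →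
                          ∃ λ z → ¬ z ≈ 0# × x * z ⋆ ≈ 0# × z * y ⋆ ≈ 0#
  walk₂⇒commonNeighbour (step adj@(_ , (z≉0 , _) , _) w) =
    _ , z≉0 , adj⇒x*y⋆≈0 adj , walk₁⇒x*y⋆≈0 w

lemma4p6 : {c ℓ : Level} (R : Ring c ℓ) (_⋆ : Ring.Carrier R → Ring.Carrier R) →
    IsInvolution R _⋆ →
    StarRingDefs.IsPQBaer R _⋆ →
    (e f : Ring.Carrier R) →
    StarRingDefs.IsCentralProjection R _⋆ e →
    StarRingDefs.IsCentralProjection R _⋆ f →
    ¬ Ring._≈_ R e (Ring.0# R) → ¬ Ring._≈_ R e (Ring.1# R) →
    ¬ Ring._≈_ R f (Ring.0# R) → ¬ Ring._≈_ R f (Ring.1# R) →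
    ¬ Ring._≈_ R (Ring._+_ R e f) (Ring.1# R) →
    Ring._≈_ R (Ring._*_ R e f) (Ring.0# R) →
    StarRingDefs.Dist R _⋆ (Ring._-_ R (Ring.1# R) e) (Ring._-_ R (Ring.1# R) f) 3
lemma4p6 R _⋆ involution _ e f ce@((ee≈e , e⋆≈e) , e-central) cf@((ff≈f , f⋆≈f) , f-central)
         e≉0 e≉1 f≉0 f≉1 e+f≉1 ef≈0 = walk , noShorterWalk
  where
  open Ring R
  open RingLemmas R
  open InvolutionLemmas R _⋆ involution
  open GraphLemmas R _⋆ involution
  open StarRingDefs R _⋆

  fe≈0 : f * e ≈ 0#
  fe≈0 = trans (sym (e-central f)) ef≈0

  walk : Walk (1# - e) (1# - f) 3
  walk with (ve , v1-e) ← nontrivial⇒isVertex ce e≉0 e≉1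
          | (vf , v1-f) ← nontrivial⇒isVertex cf f≉0 f≉1 =
    step (orthogonal⇒adj (complement-isCentralProjection ce) v1-e ve e⋆≈e (x*x≈x⇒[1-x]*x≈0 ee≈e))
    (step (orthogonal⇒adj ce ve vf f⋆≈f ef≈0)
    (step (orthogonal⇒adj cf vf v1-f ([1-x]⋆≈1-x f⋆≈f) (x*x≈x⇒x*[1-x]≈0 ff≈f))
    (here v1-f refl)))

  noShorterWalk : ∀ m → m < 3 → ¬ Walk (1# - e) (1# - f) m
  noShorterWalk 0 _ w = e≉0 (x*x≈x⇒x*y≈0⇒x≈y⇒x≈0 ee≈e ef≈0 (1-x≈1-y⇒x≈y (walk₀⇒≈ w)))
  noShorterWalk 1 _ w = e+f≉1 ([1-x]*[1-y]≈0⇒x+y≈1 f-central fe≈0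
    (x*[1-p]⋆≈0⇒x*[1-p]≈0 f⋆≈f (walk₁⇒x*y⋆≈0 w)))
  noShorterWalk 2 _ w with (y , y≉0 , [1-e]y⋆≈0 , y[1-f]⋆≈0) ← walk₂⇒commonNeighbour w =
    y≉0 (x≈x*p⇒x≈x*q⇒q*p≈0⇒x≈0
          (x*[1-y]≈0⇒x≈x*y (x*[1-p]⋆≈0⇒x*[1-p]≈0 e⋆≈e (x*y⋆≈0⇒y*x⋆≈0 [1-e]y⋆≈0)))
          (x*[1-y]≈0⇒x≈x*y (x*[1-p]⋆≈0⇒x*[1-p]≈0 f⋆≈f y[1-f]⋆≈0))
          fe≈0)
  noShorterWalk (suc (suc (suc _))) (s≤s (s≤s (s≤s ())))
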